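{- In the untyped probabilistic call-by-value $\lambda$-calculus $\Lambda_\oplus$, let $\Omega=(\lambda x.xx)(\lambda x.xx)$, $I=\lambda z.z$, $L_0=\lambda y.\Omega$ and $L_1=\lambda y.I$. For every term $P$ such that $P[L_0/x]$ (equivalently $P[L_1/x]$) is closed and every real $p$, if $P[L_0/x]\Rightarrow p$ then there is a real $q\geq p$ such that $P[L_1/x]\Rightarrow q$.
   Context: $\Lambda_\oplus$ terms: $M::=x\mid\lambda x.M\mid MM\mid M\oplus M$; values are closed abstractions $\lambda x.M$. One-step call-by-value reduction maps a closed term to a finite sequence of closed terms: $(\lambda x.M)V\to M[V/x]$ for a value $V$, $M\oplus N\to M,N$, closed under evaluation contexts $E::=[\cdot]\mid EM\mid VE$ (if $M\to N_1,\dots,N_k$ then $E[M]\to E[N_1],\dots,E[N_k]$). The relation $\Rightarrow$ between closed terms and subprobability distributions on values is inductively defined by: $M\Rightarrow\emptyset$; $V\Rightarrow\{V^1\}$; if $M\to N_1,\dots,N_k$ and $N_i\Rightarrow\mathscr{D}_i$ then $M\Rightarrow\sum_i\frac1k\mathscr{D}_i$. $M\Rightarrow p$ means there is $\mathscr{D}$ with $M\Rightarrow\mathscr{D}$ and $\sum\mathscr{D}=p$.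
   Formalization: The number p ranges over the rationals rather than all reals, and the witness q and the weights of the subprobability distributions are likewise rational. -}

module Defs where

open import Data.Nat using (ℕ; suc)
open import Data.Nat.Properties using (_≟_)
open import Data.Integer using (+_)
open import Data.Rational using (ℚ; _/_; _*_; _+_; 0ℚ; 1ℚ)
open import Data.List using (List; []; _∷_; map; length; concatMap)
open import Data.List.Relation.Binary.Pointwise using (Pointwise)
open import Data.Product using (Σ; _×_; _,_)
open import Relation.Nullary using (¬_; yes; no)
open import Relation.Binary.PropositionalEquality using (_≡_)

data Term : Set where
  var : ℕ → Term
  lam : ℕ → Term → Term
  app : Term → Term → Term
  _⊕_ : Term → Term → Term

data FreeIn (x : ℕ) : Term → Set where
  fv-var  : FreeIn x (var x)
  fv-lam  : ∀ {y M} → ¬ (x ≡ y) → FreeIn x M → FreeIn x (lam y M)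
  fv-appl : ∀ {M N} → FreeIn x M → FreeIn x (app M N)
  fv-appr : ∀ {M N} → FreeIn x N → FreeIn x (app M N)
  fv-ol   : ∀ {M N} → FreeIn x M → FreeIn x (M ⊕ N)
  fv-or   : ∀ {M N} → FreeIn x N → FreeIn x (M ⊕ N)

Closed : Term → Set
Closed M = ∀ x → ¬ FreeIn x M

-- Substitution M[N/x].  It is only ever used with N closed, in which case
-- no variable capture can occur, so no renaming is needed.
_[_/_] : Term → Term → ℕ → Term
var y [ N / x ] with x ≟ y
... | yes _ = N
... | no  _ = var y
lam y M [ N / x ] with x ≟ y
... | yes _ = lam y M
... | no  _ = lam y (M [ N / x ])
app M M' [ N / x ] = app (M [ N / x ]) (M' [ N / x ])
(M ⊕ M') [ N / x ] = (M [ N / x ]) ⊕ (M' [ N / x ])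

-- Values: (closed) abstractions.  Reduction is only applied to closed terms.
data IsValue : Term → Set where
  val-lam : ∀ x M → IsValue (lam x M)

data _⟶_ : Term → List Term → Set where
  β     : ∀ {x M V} → IsValue V → app (lam x M) V ⟶ (M [ V / x ] ∷ [])
  choice : ∀ {M N} → (M ⊕ N) ⟶ (M ∷ N ∷ [])
  ctxL  : ∀ {M Ns N} → M ⟶ Ns → app M N ⟶ map (λ M' → app M' N) Ns
  ctxR  : ∀ {V M Ns} → IsValue V → M ⟶ Ns → app V M ⟶ map (app V) Ns

-- Subprobability distributions on values, as finite formal sums
-- (lists of value/weight pairs).
Dist : Set
Dist = List (Term × ℚ)

mass : Dist → ℚ
mass [] = 0ℚ
mass ((_ , w) ∷ D) = w + mass D

scale : ℚ → Dist → Dist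
scale r = map (λ { (V , w) → (V , r * w) })

-- (1/k) Σᵢ Dᵢ for k = suc n
avg : (n : ℕ) → List Dist → Dist
avg n = concatMap (scale ((+ 1) / suc n))

-- Big-step approximation semantics M ⇒ 𝒟.
-- (Reduction always yields a nonempty list, so k = suc (length Ns).)
data _⇒_ : Term → Dist → Set where
  ⇒-∅    : ∀ {M} → M ⇒ []
  ⇒-val  : ∀ {V} → IsValue V → V ⇒ ((V , 1ℚ) ∷ [])
  ⇒-step : ∀ {M N Ns Ds} → M ⟶ (N ∷ Ns) → Pointwise _⇒_ (N ∷ Ns) Ds →
           M ⇒ avg (length Ns) Ds

_⇒ₚ_ : Term → ℚ → Set
M ⇒ₚ p = Σ Dist (λ D → (M ⇒ D) × mass D ≡ p)

Δ : Term
Δ = lam 0 (app (var 0) (var 0))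

Ω : Term
Ω = app Δ Δ

I : Term
I = lam 2 (var 2)

L₀ : Term
L₀ = lam 1 Ω

L₁ : Term
L₁ = lam 1 I

module Submission where

-- Replacing occurrences of L₀ = λy.Ω by L₁ = λy.I can only
-- increase the probability of convergence, because every computation that
-- uses L₀ proceeds identically with L₁ until the moment L₀ is applied; from
-- then on the L₀-side is Ω inside an evaluation context, which loops
-- deterministically and contributes nothing.

open import Defs
open import Data.Nat using (ℕ; zero; suc)
open import Data.Nat.Properties using (_≟_; suc-injective)
open import Data.Integer using (+_)
open import Data.Rational using (ℚ; _≤_; _/_; _*_; _+_)
import Data.Rational.Properties as QP
open import Data.Product using (Σ; _×_; _,_)
open import Data.Sum using (_⊎_; inj₁; inj₂)
open import Data.List using (List; []; _∷_; _++_)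
open import Data.List.Relation.Binary.Pointwise using (Pointwise; []; _∷_)
import Data.List.Relation.Binary.Pointwise as Pointwise
open import Data.List.Relation.Binary.Pointwise.Properties using (Pointwise-length)
open import Data.Empty using (⊥-elim)
open import Relation.Nullary using (¬_; yes; no)
open import Relation.Binary.PropositionalEquality
  using (_≡_; refl; sym; cong; module ≡-Reasoning)

mass-++ : ∀ D E → mass (D ++ E) ≡ mass D + mass E
mass-++ [] E = sym (QP.+-identityˡ (mass E))
mass-++ ((_ , w) ∷ D) E = begin
  w + mass (D ++ E)       ≡⟨ cong (λ z → w + z) (mass-++ D E) ⟩
  w + (mass D + mass E)   ≡⟨ QP.+-assoc w (mass D) (mass E) ⟨
  (w + mass D) + mass E   ∎
  where open ≡-Reasoning

mass-scale : ∀ r D → mass (scale r D) ≡ r * mass D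
mass-scale r [] = sym (QP.*-zeroʳ r)
mass-scale r ((_ , w) ∷ D) = begin
  r * w + mass (scale r D)  ≡⟨ cong (λ z → r * w + z) (mass-scale r D) ⟩
  r * w + r * mass D        ≡⟨ QP.*-distribˡ-+ r w (mass D) ⟨
  r * (w + mass D)          ∎
  where open ≡-Reasoning

mass-avg-∷ : ∀ n D Ds →
  mass (avg n (D ∷ Ds)) ≡ ((+ 1) / suc n) * mass D + mass (avg n Ds)
mass-avg-∷ n D Ds = begin
  mass (scale w D ++ avg n Ds)        ≡⟨ mass-++ (scale w D) (avg n Ds) ⟩
  mass (scale w D) + mass (avg n Ds)  ≡⟨ cong (λ z → z + mass (avg n Ds)) (mass-scale w D) ⟩
  w * mass D + mass (avg n Ds)        ∎
  where
  open ≡-Reasoning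
  w = (+ 1) / suc n

_≤ₘ_ : Dist → Dist → Set
D ≤ₘ D' = mass D ≤ mass D'

avg-mono : ∀ {m n Ds Ds'} → m ≡ n → Pointwise _≤ₘ_ Ds Ds' → avg m Ds ≤ₘ avg n Ds'
avg-mono refl [] = QP.≤-refl
avg-mono {n = n} {D ∷ Ds} {D' ∷ Ds'} refl (D≤D' ∷ Ds≤Ds')
  rewrite mass-avg-∷ n D Ds | mass-avg-∷ n D' Ds' =
  QP.+-mono-≤ (QP.*-monoˡ-≤-nonNeg ((+ 1) / suc n) {{QP.normalize-nonNeg 1 (suc n)}} D≤D')
              (avg-mono {n = n} refl Ds≤Ds')

data Looping : Term → Set where
  loop-Ω : Looping Ω
  loop-L : ∀ {M N} → Looping M → Looping (app M N)
  loop-R : ∀ {V M} → IsValue V → Looping M → Looping (app V M)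

looping-not-value : ∀ {M} → Looping M → ¬ IsValue M
looping-not-value loop-Ω ()
looping-not-value (loop-L _) ()
looping-not-value (loop-R _ _) ()

looping-step : ∀ {M Ms} → Looping M → M ⟶ Ms →
               Σ Term (λ M' → (Ms ≡ M' ∷ []) × Looping M')
looping-step loop-Ω (β _) = Ω , refl , loop-Ω
looping-step loop-Ω (ctxL ())
looping-step loop-Ω (ctxR _ ())
looping-step (loop-L l) (β v) = ⊥-elim (looping-not-value l (val-lam _ _))
looping-step (loop-L l) (ctxL st) with looping-step l st
... | M' , refl , l' = app M' _ , refl , loop-L l'
looping-step (loop-L l) (ctxR v _) = ⊥-elim (looping-not-value l v)
looping-step (loop-R _ l) (β v) = ⊥-elim (looping-not-value l v)
looping-step (loop-R (val-lam _ _) _) (ctxL ())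
looping-step (loop-R v l) (ctxR _ st) with looping-step l st
... | M' , refl , l' = app _ M' , refl , loop-R v l'

looping-⇒∅ : ∀ {M D} → Looping M → M ⇒ D → D ≡ []
looping-⇒∅ l ⇒-∅ = refl
looping-⇒∅ l (⇒-val v) = ⊥-elim (looping-not-value l v)
looping-⇒∅ l (⇒-step st M'⇒D) with looping-step l st
looping-⇒∅ l (⇒-step st (M'⇒D ∷ [])) | _ , refl , l' with looping-⇒∅ l' M'⇒D
... | refl = refl

data _≼_ : Term → Term → Set where
  ≼-var : ∀ y → var y ≼ var y
  ≼-lam : ∀ y {A B} → A ≼ B → lam y A ≼ lam y B
  ≼-app : ∀ {A B C D} → A ≼ B → C ≼ D → app A C ≼ app B D
  ≼-⊕   : ∀ {A B C D} → A ≼ B → C ≼ D → (A ⊕ C) ≼ (B ⊕ D)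
  ≼-L   : L₀ ≼ L₁

≼-refl : ∀ M → M ≼ M
≼-refl (var y) = ≼-var y
≼-refl (lam y M) = ≼-lam y (≼-refl M)
≼-refl (app M N) = ≼-app (≼-refl M) (≼-refl N)
≼-refl (M ⊕ N) = ≼-⊕ (≼-refl M) (≼-refl N)

≼-instance : ∀ x P → (P [ L₀ / x ]) ≼ (P [ L₁ / x ])
≼-instance x (var y) with x ≟ y
... | yes _ = ≼-L
... | no  _ = ≼-var y
≼-instance x (lam y P) with x ≟ y
... | yes _ = ≼-refl (lam y P)
... | no  _ = ≼-lam y (≼-instance x P)
≼-instance x (app P Q) = ≼-app (≼-instance x P) (≼-instance x Q)
≼-instance x (P ⊕ Q) = ≼-⊕ (≼-instance x P) (≼-instance x Q)

-- L₀ and L₁ are closed, so substitution leaves them unchanged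
-- (the case split follows the bound and free variables 0, 1, 2).
L₀-subst : ∀ V y → L₀ [ V / y ] ≡ L₀
L₀-subst V zero = refl
L₀-subst V (suc zero) = refl
L₀-subst V (suc (suc y)) = refl

L₁-subst : ∀ V y → L₁ [ V / y ] ≡ L₁
L₁-subst V zero = refl
L₁-subst V (suc zero) = refl
L₁-subst V (suc (suc zero)) = refl
L₁-subst V (suc (suc (suc y))) = refl

≼-subst : ∀ {A A' V V'} y → A ≼ A' → V ≼ V' → (A [ V / y ]) ≼ (A' [ V' / y ])
≼-subst y (≼-var z) V≼V' with y ≟ z
... | yes _ = V≼V'
... | no  _ = ≼-var z
≼-subst y (≼-lam z A≼A') V≼V' with y ≟ z
... | yes _ = ≼-lam z A≼A'
... | no  _ = ≼-lam z (≼-subst y A≼A' V≼V')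
≼-subst y (≼-app r s) V≼V' = ≼-app (≼-subst y r V≼V') (≼-subst y s V≼V')
≼-subst y (≼-⊕ r s) V≼V' = ≼-⊕ (≼-subst y r V≼V') (≼-subst y s V≼V')
≼-subst {V = V} {V'} y ≼-L _ rewrite L₀-subst V y | L₁-subst V' y = ≼-L

≼-value : ∀ {V N} → V ≼ N → IsValue V → IsValue N
≼-value (≼-lam _ _) _ = val-lam _ _
≼-value ≼-L _ = val-lam _ _

-- A step of M is matched by a step of N into pointwise related terms,
-- unless it applies L₀, in which case M steps to a looping term.
≼-step : ∀ {M N Ms} → M ≼ N → M ⟶ Ms →
  Σ (List Term) (λ Ns → (N ⟶ Ns) × Pointwise _≼_ Ms Ns) ⊎
  Σ Term (λ M' → (Ms ≡ M' ∷ []) × Looping M')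
≼-step (≼-app (≼-lam y A≼A') V≼V') (β v) =
  inj₁ (_ , β (≼-value V≼V' v) , ≼-subst y A≼A' V≼V' ∷ [])
≼-step (≼-app ≼-L _) (β _) = inj₂ (Ω , refl , loop-Ω)
≼-step (≼-⊕ r s) choice = inj₁ (_ , choice , r ∷ s ∷ [])
≼-step (≼-app r s) (ctxL st) with ≼-step r st
... | inj₁ (_ , st' , rs) =
      inj₁ (_ , ctxL st' , Pointwise.map⁺ _ _ (Pointwise.map (λ r' → ≼-app r' s) rs))
... | inj₂ (_ , refl , l) = inj₂ (_ , refl , loop-L l)
≼-step (≼-app r s) (ctxR v st) with ≼-step s st
... | inj₁ (_ , st' , ss) =
      inj₁ (_ , ctxR (≼-value r v) st' , Pointwise.map⁺ _ _ (Pointwise.map (≼-app r) ss))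
... | inj₂ (_ , refl , l) = inj₂ (_ , refl , loop-R v l)

mutual
  ≼-simulation : ∀ {M N D} → M ≼ N → M ⇒ D → Σ Dist (λ D' → (N ⇒ D') × D ≤ₘ D')
  ≼-simulation _ ⇒-∅ = [] , ⇒-∅ , QP.≤-refl
  ≼-simulation r (⇒-val v) = _ , ⇒-val (≼-value r v) , QP.≤-refl
  ≼-simulation r (⇒-step st Ms⇒Ds) with ≼-step r st
  ... | inj₁ (_ ∷ _ , st' , rs) with ≼-simulation-all rs Ms⇒Ds
  ...   | Ds' , Ns⇒Ds' , Ds≤Ds' =
          _ , ⇒-step st' Ns⇒Ds' , avg-mono (suc-injective (Pointwise-length rs)) Ds≤Ds'
  ≼-simulation r (⇒-step st (M'⇒D ∷ [])) | inj₂ (_ , refl , l) with looping-⇒∅ l M'⇒D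
  ... | refl = [] , ⇒-∅ , QP.≤-refl

  ≼-simulation-all : ∀ {Ms Ns Ds} → Pointwise _≼_ Ms Ns → Pointwise _⇒_ Ms Ds →
    Σ (List Dist) (λ Ds' → Pointwise _⇒_ Ns Ds' × Pointwise _≤ₘ_ Ds Ds')
  ≼-simulation-all [] [] = [] , [] , []
  ≼-simulation-all (r ∷ rs) (M⇒D ∷ Ms⇒Ds) with ≼-simulation r M⇒D | ≼-simulation-all rs Ms⇒Ds
  ... | D' , N⇒D' , D≤D' | Ds' , Ns⇒Ds' , Ds≤Ds' = D' ∷ Ds' , N⇒D' ∷ Ns⇒Ds' , D≤D' ∷ Ds≤Ds'

mainTheorem13 : (x : ℕ) (P : Term) (p : ℚ) →
    Closed (P [ L₀ / x ]) →
    (P [ L₀ / x ]) ⇒ₚ p →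
    Σ ℚ (λ q → (p ≤ q) × ((P [ L₁ / x ]) ⇒ₚ q))
mainTheorem13 x P _ _ (D , P₀⇒D , refl) with ≼-simulation (≼-instance x P) P₀⇒D
... | D' , P₁⇒D' , D≤D' = mass D' , D≤D' , D' , P₁⇒D' , refl
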